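{- Let $\alpha,n\in\mathbb{Z}^+$, $C=[n]$ and $(A,B)\in\mathcal{T}(\alpha,C)$. Then for every $m\in\mathbb{Z}$, either $|A\cap(B+m)|=1$ or $|C\cap(B+m)|<|B+m|$.
   Context: $[n]=\{1,\dots,n\}$; $B+m=\{b+m:b\in B\}$. $A+B$ is the Minkowski sum. For finite $C\subset\mathbb{Z}$ and $\alpha\in\mathbb{Z}^+$, $\mathcal{T}(\alpha,C)$ is the set of pairs $(A,B)$ of finite subsets of $\mathbb{Z}$ with $A+B=C$, $|C|=|A||B|$, $|A|=\alpha$, $0\in B$ and $\min B\ge0$. -}

module Defs where

open import Data.Nat as ℕ using (ℕ; suc)
open import Data.Integer as ℤ using (ℤ; +_; _≤_; _≟_)
open import Data.List using (List; map; filter; deduplicate; length; cartesianProductWith; upTo)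
open import Data.List.Membership.Propositional using (_∈_)
open import Data.List.Membership.DecPropositional _≟_ using (_∈?_)
open import Data.Product using (_×_)
open import Function.Bundles using (_⇔_)
open import Relation.Binary.PropositionalEquality using (_≡_)

-- Finite subsets of ℤ are represented by lists (duplicates allowed);
-- the represented set is { x | x ∈ xs }.
FinSet : Set
FinSet = List ℤ

∣_∣ₛ : FinSet → ℕ
∣ xs ∣ₛ = length (deduplicate _≟_ xs)

_≐_ : FinSet → FinSet → Set
X ≐ Y = ∀ x → (x ∈ X) ⇔ (x ∈ Y)

_⊕_ : FinSet → FinSet → FinSet
A ⊕ B = cartesianProductWith ℤ._+_ A B

shift : FinSet → ℤ → FinSet
shift B m = map (ℤ._+ m) B

_∩_ : FinSet → FinSet → FinSet
X ∩ Y = filter (_∈? Y) X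

[_] : ℕ → FinSet
[ n ] = map (λ i → + (suc i)) (upTo n)

𝒯 : ℕ → FinSet → FinSet → FinSet → Set
𝒯 α C A B =
  ((A ⊕ B) ≐ C) ×
  (∣ C ∣ₛ ≡ ∣ A ∣ₛ ℕ.* ∣ B ∣ₛ) ×
  (∣ A ∣ₛ ≡ α) ×
  (+ 0 ∈ B) ×
  (∀ b → b ∈ B → + 0 ≤ b)

-- Since |A + B| = |A||B|, every element of A + B has exactly one representation a + b.
-- If B + m ⊆ A + B, write each b + m as a + π(b); uniqueness of representations makes
-- π an injective, hence bijective, self-map of the finite set B, so π(b) = 0 for some b
-- and then b + m ∈ A. Two elements b₁ + m, b₂ + m of A would give the two
-- representations (b₁ + m) + b₂ = (b₂ + m) + b₁, so there is only one. Otherwise some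
-- element of B + m lies outside C, and C ∩ (B + m) misses it.
module Submission where

open import Defs
open import Data.Nat as ℕ using (ℕ; _<_; _≤_; z≤n; s≤s; NonZero)
import Data.Nat.Properties as ℕ
open import Data.Integer using (ℤ; +_; _+_; _≟_)
open import Data.Integer.Properties using (+-identityʳ; +-commutativeSemigroup; +-0-abelianGroup)
open import Algebra.Properties.CommutativeSemigroup +-commutativeSemigroup using (xy∙z≈xz∙y; xy∙z≈zy∙x)
open import Algebra.Properties.AbelianGroup +-0-abelianGroup using () renaming (∙-cancelʳ to +-cancelʳ)
open import Data.List using (List; []; _∷_; _++_; map; length; deduplicate; cartesianProductWith; cartesianProduct)
open import Data.List.Properties using (length-++; length-map; length-removeAt′)
open import Data.List.Relation.Unary.Any using (here; there; _─_)
open import Data.List.Relation.Unary.All as All using (all?)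
open import Data.List.Relation.Unary.All.Properties using (¬All⇒Any¬)
open import Data.List.Relation.Unary.AllPairs using ([]; _∷_)
open import Data.List.Relation.Unary.Unique.Propositional using (Unique)
open import Data.List.Relation.Unary.Unique.DecPropositional.Properties using (deduplicate-!)
open import Data.List.Relation.Binary.Subset.Propositional using (_⊆_)
open import Data.List.Membership.Propositional using (_∈_; _∉_; find)
open import Data.List.Membership.Propositional.Properties
open import Data.List.Membership.DecPropositional _≟_ using (_∈?_)
import Data.List.Membership.DecPropositional as DecMembership
open import Data.Product using (∃₂; ∃-syntax; _×_; _,_; proj₁; proj₂; uncurry)
open import Data.Product.Properties using (≡-dec)
open import Data.Sum using (_⊎_; inj₁; inj₂)
open import Data.Empty using (⊥-elim)
open import Function using (_∘_)
open import Function.Bundles using (Equivalence)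
open import Relation.Nullary using (yes; no)
open import Relation.Binary.Definitions using (DecidableEquality)
open import Relation.Binary.PropositionalEquality using (_≡_; refl; sym; trans; cong; cong₂; subst; _≢_; module ≡-Reasoning)

module _ {X : Set} where

  ∈-─⁺ : ∀ {x z} {ys : List X} (x∈ys : x ∈ ys) → z ∈ ys → z ≢ x → z ∈ (ys ─ x∈ys)
  ∈-─⁺ (here refl) (here refl) z≢x = ⊥-elim (z≢x refl)
  ∈-─⁺ (here refl) (there z∈ys) _ = z∈ys
  ∈-─⁺ (there _) (here refl) _ = here refl
  ∈-─⁺ (there x∈ys) (there z∈ys) z≢x = there (∈-─⁺ x∈ys z∈ys z≢x)

  length-─< : ∀ {x} {xs : List X} (x∈xs : x ∈ xs) → length (xs ─ x∈xs) < length xs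
  length-─< {xs = xs} x∈xs = ℕ.≤-reflexive (sym (length-removeAt′ xs _))

  Unique∧⊆⇒length≤ : ∀ {xs ys : List X} → Unique xs → xs ⊆ ys → length xs ≤ length ys
  Unique∧⊆⇒length≤ {[]} _ _ = z≤n
  Unique∧⊆⇒length≤ {x ∷ xs} {ys} (x∉xs ∷ xs!) xs⊆ys =
    ℕ.≤-trans (s≤s (Unique∧⊆⇒length≤ xs! xs⊆ys─x)) (length-─< x∈ys)
    where
    x∈ys : x ∈ ys
    x∈ys = xs⊆ys (here refl)
    xs⊆ys─x : xs ⊆ (ys ─ x∈ys)
    xs⊆ys─x z∈xs = ∈-─⁺ x∈ys (xs⊆ys (there z∈xs)) (All.lookup x∉xs z∈xs ∘ sym)

  map⁺-injectiveOn : ∀ {Y : Set} (f : X → Y) {xs} →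
    (∀ {x y} → x ∈ xs → y ∈ xs → f x ≡ f y → x ≡ y) → Unique xs → Unique (map f xs)
  map⁺-injectiveOn f {[]} _ [] = []
  map⁺-injectiveOn f {x ∷ xs} inj (x∉xs ∷ xs!) =
    All.tabulate fx≢ ∷ map⁺-injectiveOn f (λ p q → inj (there p) (there q)) xs!
    where
    fx≢ : ∀ {z} → z ∈ map f xs → f x ≢ z
    fx≢ z∈fxs fx≡z with y , y∈xs , refl ← ∈-map⁻ f z∈fxs =
      All.lookup x∉xs y∈xs (inj (here refl) (there y∈xs) fx≡z)

  length-cartesianProductWith : ∀ {Y Z : Set} (f : X → Y → Z) xs ys →
    length (cartesianProductWith f xs ys) ≡ length xs ℕ.* length ys
  length-cartesianProductWith f [] ys = refl
  length-cartesianProductWith f (x ∷ xs) ys = begin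
    length (map (f x) ys ++ cartesianProductWith f xs ys)         ≡⟨ length-++ (map (f x) ys) ⟩
    length (map (f x) ys) ℕ.+ length (cartesianProductWith f xs ys)
      ≡⟨ cong₂ ℕ._+_ (length-map (f x) ys) (length-cartesianProductWith f xs ys) ⟩
    length ys ℕ.+ length xs ℕ.* length ys                         ∎
    where open ≡-Reasoning

module _ {X : Set} (_≟ₓ_ : DecidableEquality X) where
  open DecMembership _≟ₓ_ using () renaming (_∈?_ to _∈ₓ?_)

  injectiveOn⇒surjectiveOn : ∀ {xs} (f : X → X) → Unique xs →
    (∀ {x} → x ∈ xs → f x ∈ xs) →
    (∀ {x y} → x ∈ xs → y ∈ xs → f x ≡ f y → x ≡ y) →
    ∀ {y} → y ∈ xs → ∃[ x ] x ∈ xs × f x ≡ y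
  injectiveOn⇒surjectiveOn {xs} f xs! maps-to inj {y} y∈xs with y ∈ₓ? map f xs
  ... | yes y∈fxs with x , x∈xs , y≡fx ← ∈-map⁻ f y∈fxs = x , x∈xs , sym y≡fx
  ... | no y∉fxs = ⊥-elim (ℕ.<-irrefl refl (begin-strict
    length xs               ≡⟨ length-map f xs ⟨
    length (map f xs)       ≤⟨ Unique∧⊆⇒length≤ (map⁺-injectiveOn f inj xs!) fxs⊆xs─y ⟩
    length (xs ─ y∈xs)      <⟨ length-─< y∈xs ⟩
    length xs               ∎))
    where
    open ℕ.≤-Reasoning
    fxs⊆xs─y : map f xs ⊆ (xs ─ y∈xs)
    fxs⊆xs─y z∈fxs with x , x∈xs , refl ← ∈-map⁻ f z∈fxs =
      ∈-─⁺ y∈xs (maps-to x∈xs) (λ fx≡y → y∉fxs (subst (_∈ map f xs) fx≡y z∈fxs))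

∣∣ₛ≤length : ∀ {X : FinSet} {ys} → X ⊆ ys → ∣ X ∣ₛ ≤ length ys
∣∣ₛ≤length {X} X⊆ys = Unique∧⊆⇒length≤ (deduplicate-! _≟_ X) (X⊆ys ∘ ∈-deduplicate⁻ _≟_ X)

∣∣ₛ-mono : ∀ {X Y : FinSet} → X ⊆ Y → ∣ X ∣ₛ ≤ ∣ Y ∣ₛ
∣∣ₛ-mono X⊆Y = ∣∣ₛ≤length (∈-deduplicate⁺ _≟_ ∘ X⊆Y)

∣∣ₛ-mono-< : ∀ {X Y : FinSet} {y} → X ⊆ Y → y ∈ Y → y ∉ X → ∣ X ∣ₛ < ∣ Y ∣ₛ
∣∣ₛ-mono-< {X} {Y} {y} X⊆Y y∈Y y∉X = ℕ.≤-<-trans (∣∣ₛ≤length X⊆Y─y) (length-─< y∈Y′)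
  where
  Y′ : FinSet
  Y′ = deduplicate _≟_ Y
  y∈Y′ : y ∈ Y′
  y∈Y′ = ∈-deduplicate⁺ _≟_ y∈Y
  X⊆Y─y : X ⊆ (Y′ ─ y∈Y′)
  X⊆Y─y z∈X = ∈-─⁺ y∈Y′ (∈-deduplicate⁺ _≟_ (X⊆Y z∈X)) λ { refl → y∉X z∈X }

∣∣ₛ-cong : ∀ {X Y : FinSet} → X ≐ Y → ∣ X ∣ₛ ≡ ∣ Y ∣ₛ
∣∣ₛ-cong X≐Y = ℕ.≤-antisym (∣∣ₛ-mono (Equivalence.to (X≐Y _))) (∣∣ₛ-mono (Equivalence.from (X≐Y _)))

∣∣ₛ≡1 : ∀ {X : FinSet} {a} → a ∈ X → (∀ {z} → z ∈ X → z ≡ a) → ∣ X ∣ₛ ≡ 1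
∣∣ₛ≡1 a∈X X≡a = ℕ.≤-antisym (∣∣ₛ≤length {ys = _ ∷ []} (here ∘ X≡a)) (∈-length (∈-deduplicate⁺ _≟_ a∈X))

collision⇒∣map∣ₛ<length : ∀ {X : Set} → DecidableEquality X → (f : X → ℤ) {xs : List X} {x y : X} →
  x ∈ xs → y ∈ xs → x ≢ y → f x ≡ f y → ∣ map f xs ∣ₛ < length xs
collision⇒∣map∣ₛ<length _≟ₓ_ f {xs} {x} {y} x∈xs y∈xs x≢y fx≡fy = begin-strict
  ∣ map f xs ∣ₛ              ≤⟨ ∣∣ₛ≤length fxs⊆ ⟩
  length (map f (xs ─ y∈xs))  ≡⟨ length-map f (xs ─ y∈xs) ⟩
  length (xs ─ y∈xs)          <⟨ length-─< y∈xs ⟩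
  length xs                   ∎
  where
  open ℕ.≤-Reasoning
  fxs⊆ : map f xs ⊆ map f (xs ─ y∈xs)
  fxs⊆ z∈fxs with z , z∈xs , refl ← ∈-map⁻ f z∈fxs with z ≟ₓ y
  ... | yes refl = subst (_∈ map f (xs ─ y∈xs)) fx≡fy (∈-map⁺ f (∈-─⁺ y∈xs x∈xs x≢y))
  ... | no z≢y = ∈-map⁺ f (∈-─⁺ y∈xs z∈xs z≢y)

∈-∩⁺ : ∀ {X Y : FinSet} {x} → x ∈ X → x ∈ Y → x ∈ X ∩ Y
∈-∩⁺ {Y = Y} = ∈-filter⁺ (_∈? Y)

∈-∩⁻ : ∀ {X Y : FinSet} {x} → x ∈ X ∩ Y → x ∈ X × x ∈ Y
∈-∩⁻ {Y = Y} = ∈-filter⁻ (_∈? Y)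

∣∩∣ₛ<∣∣ₛ : ∀ {X Y : FinSet} {y} → y ∈ Y → y ∉ X → ∣ X ∩ Y ∣ₛ < ∣ Y ∣ₛ
∣∩∣ₛ<∣∣ₛ {X} y∈Y y∉X = ∣∣ₛ-mono-< (proj₂ ∘ ∈-∩⁻ {X}) y∈Y (y∉X ∘ proj₁ ∘ ∈-∩⁻ {X})

⊆-or-escapes : (X Y : FinSet) → X ⊆ Y ⊎ ∃[ x ] x ∈ X × x ∉ Y
⊆-or-escapes X Y with all? (_∈? Y) X
... | yes X⊆Y = inj₁ (All.lookup X⊆Y)
... | no X⊈Y = inj₂ (find (¬All⇒Any¬ (_∈? Y) X X⊈Y))

UniqueSums : FinSet → FinSet → Set
UniqueSums A B = ∀ {a₁ a₂ b₁ b₂} → a₁ ∈ A → a₂ ∈ A → b₁ ∈ B → b₂ ∈ B →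
  a₁ + b₁ ≡ a₂ + b₂ → a₁ ≡ a₂ × b₁ ≡ b₂

∣∣ₛ*∣∣ₛ≤∣⊕∣ₛ⇒UniqueSums : ∀ {A B} → ∣ A ∣ₛ ℕ.* ∣ B ∣ₛ ≤ ∣ A ⊕ B ∣ₛ → UniqueSums A B
∣∣ₛ*∣∣ₛ≤∣⊕∣ₛ⇒UniqueSums {A} {B} big {a₁} {a₂} {b₁} {b₂} a₁∈A a₂∈A b₁∈B b₂∈B sum≡
  with ≡-dec _≟_ _≟_ (a₁ , b₁) (a₂ , b₂)
... | yes refl = refl , refl
... | no q₁≢q₂ = ⊥-elim (ℕ.<-irrefl refl (begin-strict
  ∣ A ⊕ B ∣ₛ                   ≤⟨ ∣∣ₛ-mono A⊕B⊆sums ⟩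
  ∣ map (uncurry _+_) P ∣ₛ      <⟨ collision⇒∣map∣ₛ<length (≡-dec _≟_ _≟_) (uncurry _+_)
                                    (pair∈P a₁∈A b₁∈B) (pair∈P a₂∈A b₂∈B) q₁≢q₂ sum≡ ⟩
  length P                     ≡⟨ length-cartesianProductWith _,_ A′ B′ ⟩
  ∣ A ∣ₛ ℕ.* ∣ B ∣ₛ              ≤⟨ big ⟩
  ∣ A ⊕ B ∣ₛ                   ∎))
  where
  open ℕ.≤-Reasoning
  A′ B′ : FinSet
  A′ = deduplicate _≟_ A
  B′ = deduplicate _≟_ B
  P : List (ℤ × ℤ)
  P = cartesianProduct A′ B′
  pair∈P : ∀ {a b} → a ∈ A → b ∈ B → (a , b) ∈ P
  pair∈P a∈A b∈B = ∈-cartesianProduct⁺ (∈-deduplicate⁺ _≟_ a∈A) (∈-deduplicate⁺ _≟_ b∈B)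
  A⊕B⊆sums : A ⊕ B ⊆ map (uncurry _+_) P
  A⊕B⊆sums z∈A⊕B with _ , _ , a∈A , b∈B , refl ← ∈-cartesianProductWith⁻ _+_ A B z∈A⊕B =
    ∈-map⁺ (uncurry _+_) (pair∈P a∈A b∈B)

tiling⇒UniqueSums : ∀ {A B C} → (A ⊕ B) ≐ C → ∣ C ∣ₛ ≡ ∣ A ∣ₛ ℕ.* ∣ B ∣ₛ → UniqueSums A B
tiling⇒UniqueSums A⊕B≐C ∣C∣≡ =
  ∣∣ₛ*∣∣ₛ≤∣⊕∣ₛ⇒UniqueSums (ℕ.≤-reflexive (trans (sym ∣C∣≡) (sym (∣∣ₛ-cong A⊕B≐C))))

cross-sums : ∀ a₁ a₂ b₁ b₂ c m → b₁ + m ≡ a₁ + c → b₂ + m ≡ a₂ + c → a₁ + b₂ ≡ a₂ + b₁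
cross-sums a₁ a₂ b₁ b₂ c m e₁ e₂ = +-cancelʳ c (a₁ + b₂) (a₂ + b₁) (begin
  (a₁ + b₂) + c  ≡⟨ xy∙z≈xz∙y a₁ b₂ c ⟩
  (a₁ + c) + b₂  ≡⟨ cong (_+ b₂) e₁ ⟨
  (b₁ + m) + b₂  ≡⟨ xy∙z≈zy∙x b₁ m b₂ ⟩
  (b₂ + m) + b₁  ≡⟨ cong (_+ b₁) e₂ ⟩
  (a₂ + c) + b₁  ≡⟨ xy∙z≈xz∙y a₂ b₁ c ⟨
  (a₂ + b₁) + c  ∎)
  where open ≡-Reasoning

module _ {A B : FinSet} (unique : UniqueSums A B) (m : ℤ) where

  A∩shift-subsingleton : ∀ {a a′} → a ∈ A → a ∈ shift B m → a′ ∈ A → a′ ∈ shift B m → a ≡ a′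
  A∩shift-subsingleton a∈A a∈S a′∈A a′∈S
    with b₁ , b₁∈B , refl ← ∈-map⁻ (_+ m) a∈S
       | b₂ , b₂∈B , refl ← ∈-map⁻ (_+ m) a′∈S =
    proj₁ (unique a∈A a′∈A b₂∈B b₁∈B (xy∙z≈zy∙x b₁ m b₂))

  module _ (shift⊆A⊕B : shift B m ⊆ A ⊕ B) where

    decompose : ∀ {b} → b ∈ B → ∃₂ λ a c → a ∈ A × c ∈ B × b + m ≡ a + c
    decompose b∈B = ∈-cartesianProductWith⁻ _+_ A B (shift⊆A⊕B (∈-map⁺ (_+ m) b∈B))

    partner : ℤ → ℤ
    partner b with b ∈? B
    ... | yes b∈B = proj₁ (proj₂ (decompose b∈B))
    ... | no _ = b

    partner-spec : ∀ {b} → b ∈ B → ∃[ a ] a ∈ A × partner b ∈ B × b + m ≡ a + partner b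
    partner-spec {b} b∈B with b ∈? B
    ... | no b∉B = ⊥-elim (b∉B b∈B)
    ... | yes b∈B′ with decompose b∈B′
    ...   | a , c , a∈A , c∈B , eq = a , a∈A , c∈B , eq

    partner-injectiveOn : ∀ {b₁ b₂} → b₁ ∈ B → b₂ ∈ B → partner b₁ ≡ partner b₂ → b₁ ≡ b₂
    partner-injectiveOn {b₁} {b₂} b₁∈B b₂∈B π≡
      with a₁ , a₁∈A , _ , e₁ ← partner-spec b₁∈B
         | a₂ , a₂∈A , _ , e₂ ← partner-spec b₂∈B =
      sym (proj₂ (unique a₁∈A a₂∈A b₂∈B b₁∈B
        (cross-sums a₁ a₂ b₁ b₂ (partner b₁) m e₁ (trans e₂ (cong (_+_ a₂) (sym π≡))))))

    partner-surjectiveOn : ∀ {b′} → b′ ∈ B → ∃[ b ] b ∈ B × partner b ≡ b′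
    partner-surjectiveOn b′∈B
      with b , b∈B′ , πb≡b′ ← injectiveOn⇒surjectiveOn _≟_ partner (deduplicate-! _≟_ B)
             (∈-deduplicate⁺ _≟_ ∘ proj₁ ∘ proj₂ ∘ proj₂ ∘ partner-spec ∘ ∈-deduplicate⁻ _≟_ B)
             (λ b₁∈B′ b₂∈B′ → partner-injectiveOn (∈-deduplicate⁻ _≟_ B b₁∈B′) (∈-deduplicate⁻ _≟_ B b₂∈B′))
             (∈-deduplicate⁺ _≟_ b′∈B) =
      b , ∈-deduplicate⁻ _≟_ B b∈B′ , πb≡b′

    shift-meets-A : + 0 ∈ B → ∃[ a ] a ∈ A × a ∈ shift B m
    shift-meets-A 0∈B
      with b , b∈B , πb≡0 ← partner-surjectiveOn 0∈B
      with a , a∈A , _ , b+m≡a+πb ← partner-spec b∈B =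
      a , a∈A , subst (_∈ shift B m) b+m≡a (∈-map⁺ (_+ m) b∈B)
      where
      b+m≡a : b + m ≡ a
      b+m≡a = trans b+m≡a+πb (trans (cong (_+_ a) πb≡0) (+-identityʳ a))

    ∣A∩shift∣ₛ≡1 : + 0 ∈ B → ∣ A ∩ shift B m ∣ₛ ≡ 1
    ∣A∩shift∣ₛ≡1 0∈B with a , a∈A , a∈S ← shift-meets-A 0∈B =
      ∣∣ₛ≡1 (∈-∩⁺ a∈A a∈S) λ z∈A∩S →
        A∩shift-subsingleton (proj₁ (∈-∩⁻ z∈A∩S)) (proj₂ (∈-∩⁻ {A} z∈A∩S)) a∈A a∈S

lemma14 : (α n : ℕ) → NonZero α → NonZero n → (A B : FinSet) →
    𝒯 α [ n ] A B →
    (m : ℤ) → (∣ A ∩ shift B m ∣ₛ ≡ 1) ⊎ (∣ [ n ] ∩ shift B m ∣ₛ < ∣ shift B m ∣ₛ)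
lemma14 _ n _ _ A B (A⊕B≐[n] , ∣[n]∣≡ , _ , 0∈B , _) m with ⊆-or-escapes (shift B m) [ n ]
... | inj₁ shift⊆[n] =
  inj₁ (∣A∩shift∣ₛ≡1 (tiling⇒UniqueSums {A} {B} A⊕B≐[n] ∣[n]∣≡) m
         (Equivalence.from (A⊕B≐[n] _) ∘ shift⊆[n]) 0∈B)
... | inj₂ (x , x∈shift , x∉[n]) = inj₂ (∣∩∣ₛ<∣∣ₛ x∈shift x∉[n])
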